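{- Let $N\ge1$, $f:\mathbb{N}^N\to\mathbb{N}$, $p$ a prime, $n$ a nonnegative integer and $\mathbf{m}\in\mathbb{N}^N$. Then $$\binom{np}{p\mathbf{m}}_f\equiv\binom{n}{\mathbf{m}}_f\pmod p.$$
   Context: $\mathbb{N}=\{0,1,2,\dots\}$. For $k\ge0$ and $\boldsymbol{\ell}\in\mathbb{N}^N$, $\binom{k}{\boldsymbol{\ell}}_f=\sum f(\mathbf{m}_1)\cdots f(\mathbf{m}_k)$ over all ordered $k$-tuples of vectors $\mathbf{m}_j\in\mathbb{N}^N$ with $\mathbf{m}_1+\cdots+\mathbf{m}_k=\boldsymbol{\ell}$ (for $k=0$: $1$ if $\boldsymbol{\ell}=\mathbf{0}$, else $0$). -}

module Defs where

open import Data.Nat using (ℕ; zero; suc; _+_; _*_; _≟_)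
open import Data.List using (List; []; _∷_; [_]; map; concatMap; upTo; filter)
open import Data.Nat.ListAction using (sum)
open import Data.Vec using (Vec; []; _∷_; zipWith; replicate; foldr)
import Data.Vec as V
open import Data.Vec.Properties using (≡-dec)

-- all vectors m ∈ ℕ^N with m ≤ ℓ componentwise (a finite superset of the
-- possible summands m_j, since m_1 + ... + m_k = ℓ forces m_j ≤ ℓ)
box : {N : ℕ} → Vec ℕ N → List (Vec ℕ N)
box []      = [ [] ]
box (x ∷ ℓ) = concatMap (λ a → map (a ∷_) (box ℓ)) (upTo (suc x))

tuplesFrom : {A : Set} → (k : ℕ) → List A → List (Vec A k)
tuplesFrom zero    xs = [ [] ]
tuplesFrom (suc k) xs = concatMap (λ x → map (x ∷_) (tuplesFrom k xs)) xs

vsum : {N k : ℕ} → Vec (Vec ℕ N) k → Vec ℕ N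
vsum {N} = foldr _ (zipWith _+_) (replicate N 0)

compositions : {N : ℕ} → (k : ℕ) → Vec ℕ N → List (Vec (Vec ℕ N) k)
compositions k ℓ = filter (λ t → ≡-dec _≟_ (vsum t) ℓ) (tuplesFrom k (box ℓ))

gbinom : {N : ℕ} → (Vec ℕ N → ℕ) → ℕ → Vec ℕ N → ℕ
gbinom f k ℓ = sum (map (λ t → foldr _ (λ m r → f m * r) 1 t) (compositions k ℓ))

_·v_ : {N : ℕ} → ℕ → Vec ℕ N → Vec ℕ N
c ·v m = V.map (c *_) m

-- Let F be the polynomial Σ f(w) xʷ over the vectors w ≤ p m, so that
-- binom(k, ℓ)_f is the coefficient of xˡ in Fᵏ for every ℓ ≤ p m. Over ℤ/p the
-- Frobenius map is additive, hence Fᵖ ≡ F(xᵖ) (mod p) and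
--   F^{np} = (Fᵖ)ⁿ ≡ F(xᵖ)ⁿ = (Fⁿ)(xᵖ)  (mod p);
-- comparing the coefficients of x^{pm} on both sides gives the theorem.
module Submission where

open import Defs
open import Data.Nat using (ℕ; _*_; _≥_)
open import Data.Nat.Primality using (Prime)
open import Data.Vec using (Vec)
open import Data.Integer using (+_; _-_)
open import Data.Integer.Divisibility using (_∣_)

open import Level using (0ℓ)
open import Data.Nat using (zero; suc; _+_; _∸_; _≤_; _<_; s≤s; z≤n; _≟_; NonZero; _!; nonTrivial⇒≢1)
open import Data.Nat.Properties
open import Data.Nat.DivMod using (_%_; _/_; %-distribˡ-+; %-distribˡ-*; m*n%n≡0; m≡m%n+[m/n]*n; m/n*n≡m)
import Data.Nat.Divisibility as ℕ
open import Data.Nat.Primality using (euclidsLemma; prime⇒nonZero; prime⇒nonTrivial)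
open import Data.Nat.Combinatorics using (_C_; nCn≡1; nCk≡n!/k![n-k]!; k![n∸k]!∣n!)
import Data.Integer as ℤ
open import Data.Integer.Properties using (m-n≡m⊖n; ⊖-≥; ∣⊖∣-≤)
open import Data.Product using (_×_; _,_)
open import Data.Sum using (inj₁; inj₂)
open import Data.Unit using (⊤; tt)
open import Data.Fin as Fin using (fromℕ)
open import Data.Fin.Properties using (toℕ<n; toℕ-fromℕ; toℕ-inject₁)
open import Data.List as List using (List; []; _∷_; [_]; _++_; concatMap; upTo; applyUpTo; filter)
import Data.List.Properties as List
open import Data.Nat.ListAction using (sum)
open import Data.Vec as Vec using ([]; _∷_; zipWith; replicate)
open import Data.Vec.Properties using (≡-dec; ∷-injectiveˡ; ∷-injectiveʳ; zipWith-comm; zipWith-assoc; zipWith-identityˡ)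
open import Data.Vec.Relation.Binary.Pointwise.Inductive as Pointwise using (Pointwise; []; _∷_)
import Data.Vec.Functional as Vector
open import Algebra.Bundles using (CommutativeSemiring)
import Algebra.Structures.Biased as Biased
open import Algebra.Properties.CommutativeSemigroup +-commutativeSemigroup using () renaming (interchange to +-interchange)
open import Function using (_∘_)
open import Function.Definitions using (Injective)
open import Relation.Nullary using (¬_; yes; no; contradiction)
open import Relation.Binary.Structures using (IsEquivalence)
open import Relation.Binary.Bundles using (Setoid)
import Relation.Binary.Reasoning.Setoid as SetoidReasoning
open import Relation.Binary.PropositionalEquality
  using (_≡_; _≢_; refl; sym; trans; cong; cong₂; subst; subst₂; isEquivalence; module ≡-Reasoning)

prime∤! : ∀ {p} → Prime p → ∀ {j} → j < p → ¬ p ℕ.∣ j !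
prime∤! p-prime {zero}  _   p∣1   = nonTrivial⇒≢1 {{prime⇒nonTrivial p-prime}} (ℕ.∣1⇒≡1 p∣1)
prime∤! p-prime {suc j} j<p p∣j+1! with euclidsLemma (suc j) (j !) p-prime p∣j+1!
... | inj₁ p∣j+1 = <⇒≱ j<p (ℕ.∣⇒≤ p∣j+1)
... | inj₂ p∣j!  = prime∤! p-prime (<-trans (n<1+n j) j<p) p∣j!

-- p divides p! = (p C k) · k! · (p ∸ k)! but neither factorial.
prime∣pCk : ∀ {p} → Prime p → ∀ {k} → 0 < k → k < p → p ℕ.∣ p C k
prime∣pCk {p@(suc q)} p-prime {k} 0<k k<p with euclidsLemma (p C k) (k ! * (p ∸ k) !) p-prime p∣product
  where
  instance _ = k !* (p ∸ k) !≢0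
  p∣product : p ℕ.∣ (p C k) * (k ! * (p ∸ k) !)
  p∣product = subst (p ℕ.∣_)
    (sym (trans (cong (_* (k ! * (p ∸ k) !)) (nCk≡n!/k![n-k]! (<⇒≤ k<p)))
                (m/n*n≡m (k![n∸k]!∣n! (<⇒≤ k<p)))))
    (ℕ.m∣m*n (q !))
... | inj₁ p∣pCk = p∣pCk
... | inj₂ p∣k![p∸k]! with euclidsLemma (k !) ((p ∸ k) !) p-prime p∣k![p∸k]!
...   | inj₁ p∣k!     = contradiction p∣k! (prime∤! p-prime k<p)
...   | inj₂ p∣[p∸k]! = contradiction p∣[p∸k]! (prime∤! p-prime (∸-monoʳ-< 0<k (<⇒≤ k<p)))

-- Frobenius in characteristic p

module _ {c ℓ} (S : CommutativeSemiring c ℓ) where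

  private module S = CommutativeSemiring S
  open S using (Carrier; _≈_; 0#)
  open import Algebra.Properties.Semiring.Mult S.semiring using (×-assocˡ; ×-homo-1) renaming (_×_ to _·_)
  open import Algebra.Properties.Semiring.Exp S.semiring using (_^_)
  open import Algebra.Properties.Monoid.Sum S.+-monoid
    using (sum-cong-≋; sum-init-last; sum-replicate-zero) renaming (sum to ∑ᵥ)
  open import Algebra.Properties.CommutativeSemiring.Binomial S using (binomialTerm; theorem)
  open SetoidReasoning S.setoid

  ∣⇒·≈0 : ∀ {p} → (∀ x → p · x ≈ 0#) → ∀ {n} → p ℕ.∣ n → ∀ x → n · x ≈ 0#
  ∣⇒·≈0 {p} p·≈0 (ℕ.divides d refl) x = begin
    (d * p) · x   ≡⟨ cong (_· x) (*-comm d p) ⟩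
    (p * d) · x   ≈⟨ ×-assocˡ x p d ⟨
    p · (d · x)   ≈⟨ p·≈0 (d · x) ⟩
    0#            ∎

  binomialTerm-last : ∀ x y n → binomialTerm x y n (fromℕ n) ≈ x ^ n
  binomialTerm-last x y n rewrite toℕ-fromℕ n | nCn≡1 n | n∸n≡0 n =
    S.trans (×-homo-1 _) (S.*-identityʳ (x ^ n))

  ^-distrib-+-prime : ∀ {p} → Prime p → (∀ x → p · x ≈ 0#) →
                      ∀ x y → (x S.+ y) ^ p ≈ x ^ p S.+ y ^ p
  ^-distrib-+-prime {zero}  p-prime _    x y = contradiction (prime⇒nonZero p-prime) λ ()
  ^-distrib-+-prime {suc q} p-prime p·≈0 x y = begin
    (x S.+ y) ^ p
      ≈⟨ theorem p x y ⟩
    t Fin.zero S.+ ∑ᵥ (Vector.tail t)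
      ≈⟨ S.+-congˡ (sum-init-last (Vector.tail t)) ⟩
    t Fin.zero S.+ (∑ᵥ middle S.+ t (fromℕ p))
      ≈⟨ S.+-congˡ (S.+-congʳ (sum-cong-≋ middle≈0)) ⟩
    t Fin.zero S.+ (∑ᵥ (Vector.replicate q 0#) S.+ t (fromℕ p))
      ≈⟨ S.+-cong (S.trans (×-homo-1 _) (S.*-identityˡ _)) (S.+-congʳ (sum-replicate-zero q)) ⟩
    y ^ p S.+ (0# S.+ t (fromℕ p))
      ≈⟨ S.+-congˡ (S.trans (S.+-identityˡ _) (binomialTerm-last x y p)) ⟩
    y ^ p S.+ x ^ p
      ≈⟨ S.+-comm _ _ ⟩
    x ^ p S.+ y ^ p ∎
    where
    p = suc q
    t = binomialTerm x y p
    middle = Vector.init (Vector.tail t)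
    middle≈0 : ∀ i → middle i ≈ 0#
    middle≈0 i = ∣⇒·≈0 p·≈0 (prime∣pCk p-prime (s≤s z≤n)
      (s≤s (subst (_< q) (sym (toℕ-inject₁ i)) (toℕ<n i)))) _

infixl 6 _⊕_ _⊖_

_⊕_ _⊖_ : ∀ {N} → Vec ℕ N → Vec ℕ N → Vec ℕ N
u ⊕ v = zipWith _+_ u v
u ⊖ v = zipWith _∸_ u v

𝟎 : ∀ {N} → Vec ℕ N
𝟎 = replicate _ 0

infix 4 _≤ᵥ_

_≤ᵥ_ : ∀ {N} → Vec ℕ N → Vec ℕ N → Set
_≤ᵥ_ = Pointwise _≤_

⊕-comm : ∀ {N} (u v : Vec ℕ N) → u ⊕ v ≡ v ⊕ u
⊕-comm = zipWith-comm +-comm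

⊕-assoc : ∀ {N} (u v w : Vec ℕ N) → (u ⊕ v) ⊕ w ≡ u ⊕ (v ⊕ w)
⊕-assoc = zipWith-assoc +-assoc

⊕-identityˡ : ∀ {N} (v : Vec ℕ N) → 𝟎 ⊕ v ≡ v
⊕-identityˡ = zipWith-identityˡ +-identityˡ

⊕-⊖-cancelˡ : ∀ {N} (u v : Vec ℕ N) → (u ⊕ v) ⊖ u ≡ v
⊕-⊖-cancelˡ []      []      = refl
⊕-⊖-cancelˡ (a ∷ u) (b ∷ v) = cong₂ _∷_ (m+n∸m≡n a b) (⊕-⊖-cancelˡ u v)

⊖-≤ᵥ : ∀ {N} {w m : Vec ℕ N} (u : Vec ℕ N) → w ≤ᵥ m → w ⊖ u ≤ᵥ m
⊖-≤ᵥ []      []          = []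
⊖-≤ᵥ (a ∷ u) (c≤b ∷ w≤m) = ≤-trans (m∸n≤m _ a) c≤b ∷ ⊖-≤ᵥ u w≤m

·v-distrib-⊕ : ∀ {N} c (u v : Vec ℕ N) → c ·v (u ⊕ v) ≡ c ·v u ⊕ c ·v v
·v-distrib-⊕ c []      []      = refl
·v-distrib-⊕ c (a ∷ u) (b ∷ v) = cong₂ _∷_ (*-distribˡ-+ c a b) (·v-distrib-⊕ c u v)

·v-zeroʳ : ∀ {N} c → c ·v 𝟎 ≡ 𝟎 {N}
·v-zeroʳ {zero}  c = refl
·v-zeroʳ {suc N} c = cong₂ _∷_ (*-zeroʳ c) (·v-zeroʳ c)

·v-zeroˡ : ∀ {N} (v : Vec ℕ N) → 0 ·v v ≡ 𝟎
·v-zeroˡ []      = refl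
·v-zeroˡ (a ∷ v) = cong (0 ∷_) (·v-zeroˡ v)

·v-suc : ∀ {N} k (v : Vec ℕ N) → suc k ·v v ≡ v ⊕ k ·v v
·v-suc k []      = refl
·v-suc k (a ∷ v) = cong (a + k * a ∷_) (·v-suc k v)

·v-injective : ∀ {N} c .{{_ : NonZero c}} → Injective _≡_ _≡_ (_·v_ {N} c)
·v-injective c {[]}    {[]}    _  = refl
·v-injective c {a ∷ u} {b ∷ v} eq =
  cong₂ _∷_ (*-cancelˡ-≡ a b c (∷-injectiveˡ eq)) (·v-injective c (∷-injectiveʳ eq))

≤ᵥ-·v : ∀ {N} {w m : Vec ℕ N} c .{{_ : NonZero c}} → w ≤ᵥ m → w ≤ᵥ c ·v m
≤ᵥ-·v c []                      = []
≤ᵥ-·v {m = b ∷ _} c (a≤b ∷ w≤m) = ≤-trans a≤b (m≤n*m b c) ∷ ≤ᵥ-·v c w≤m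

δ : ∀ {N} → Vec ℕ N → Vec ℕ N → ℕ → ℕ
δ e ℓ a with ≡-dec _≟_ e ℓ
... | yes _ = a
... | no  _ = 0

module _ {N : ℕ} where

  δ-≡ : ∀ {e ℓ : Vec ℕ N} a → e ≡ ℓ → δ e ℓ a ≡ a
  δ-≡ {e} {ℓ} a e≡ℓ with ≡-dec _≟_ e ℓ
  ... | yes _   = refl
  ... | no e≢ℓ = contradiction e≡ℓ e≢ℓ

  δ-≢ : ∀ {e ℓ : Vec ℕ N} a → e ≢ ℓ → δ e ℓ a ≡ 0
  δ-≢ {e} {ℓ} a e≢ℓ with ≡-dec _≟_ e ℓ
  ... | yes e≡ℓ = contradiction e≡ℓ e≢ℓ
  ... | no _    = refl

  δ-zero : ∀ (e ℓ : Vec ℕ N) → δ e ℓ 0 ≡ 0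
  δ-zero e ℓ with ≡-dec _≟_ e ℓ
  ... | yes _ = refl
  ... | no  _ = refl

  δ-distrib-+ : ∀ (e ℓ : Vec ℕ N) a b → δ e ℓ (a + b) ≡ δ e ℓ a + δ e ℓ b
  δ-distrib-+ e ℓ a b with ≡-dec _≟_ e ℓ
  ... | yes _ = refl
  ... | no  _ = refl

  δ-*ˡ : ∀ (e ℓ : Vec ℕ N) a b → δ e ℓ (a * b) ≡ a * δ e ℓ b
  δ-*ˡ e ℓ a b with ≡-dec _≟_ e ℓ
  ... | yes _ = refl
  ... | no  _ = sym (*-zeroʳ a)

  δ-preserves : ∀ {_∼_ : ℕ → ℕ → Set} → (∀ {x} → x ∼ x) →
                ∀ (e ℓ : Vec ℕ N) {a b} → a ∼ b → δ e ℓ a ∼ δ e ℓ b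
  δ-preserves ∼-refl e ℓ a∼b with ≡-dec _≟_ e ℓ
  ... | yes _ = a∼b
  ... | no  _ = ∼-refl

  -- v enters the right-hand side only through whether v ≡ ℓ ⊖ u.
  δ-⊕-shift : ∀ (u v ℓ : Vec ℕ N) b →
              δ (u ⊕ v) ℓ b ≡ δ (u ⊕ (ℓ ⊖ u)) ℓ (δ v (ℓ ⊖ u) b)
  δ-⊕-shift u v ℓ b with ≡-dec _≟_ (u ⊕ v) ℓ
  ... | yes u⊕v≡ℓ = sym (trans (cong (δ (u ⊕ (ℓ ⊖ u)) ℓ) (δ-≡ b v≡ℓ⊖u))
                               (δ-≡ b (trans (cong (u ⊕_) (sym v≡ℓ⊖u)) u⊕v≡ℓ)))
    where v≡ℓ⊖u = trans (sym (⊕-⊖-cancelˡ u v)) (cong (_⊖ u) u⊕v≡ℓ)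
  ... | no u⊕v≢ℓ with ≡-dec _≟_ v (ℓ ⊖ u)
  ...   | yes v≡ℓ⊖u = sym (δ-≢ b (u⊕v≢ℓ ∘ trans (cong (u ⊕_) v≡ℓ⊖u)))
  ...   | no  _      = sym (δ-zero (u ⊕ (ℓ ⊖ u)) ℓ)

δ-injective : ∀ {M N} {g : Vec ℕ M → Vec ℕ N} → Injective _≡_ _≡_ g →
              ∀ e ℓ a → δ (g e) (g ℓ) a ≡ δ e ℓ a
δ-injective {g = g} g-injective e ℓ a with ≡-dec _≟_ e ℓ
... | yes e≡ℓ = δ-≡ a (cong g e≡ℓ)
... | no  e≢ℓ = δ-≢ a (e≢ℓ ∘ g-injective)

private variable A B : Set

∑ : List A → (A → ℕ) → ℕ
∑ []       g = 0
∑ (x ∷ xs) g = g x + ∑ xs g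

∑-cong : ∀ (xs : List A) {g h : A → ℕ} → (∀ x → g x ≡ h x) → ∑ xs g ≡ ∑ xs h
∑-cong []       g≗h = refl
∑-cong (x ∷ xs) g≗h = cong₂ _+_ (g≗h x) (∑-cong xs g≗h)

∑-zero : ∀ (xs : List A) {g : A → ℕ} → (∀ x → g x ≡ 0) → ∑ xs g ≡ 0
∑-zero []       g≗0 = refl
∑-zero (x ∷ xs) g≗0 = cong₂ _+_ (g≗0 x) (∑-zero xs g≗0)

∑-++ : ∀ (xs ys : List A) (g : A → ℕ) → ∑ (xs ++ ys) g ≡ ∑ xs g + ∑ ys g
∑-++ []       ys g = refl
∑-++ (x ∷ xs) ys g = trans (cong (_+_ (g x)) (∑-++ xs ys g)) (sym (+-assoc (g x) _ _))

∑-map : (f : B → A) (xs : List B) (g : A → ℕ) → ∑ (List.map f xs) g ≡ ∑ xs (g ∘ f)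
∑-map f []       g = refl
∑-map f (x ∷ xs) g = cong (_+_ (g (f x))) (∑-map f xs g)

∑-concatMap : (F : B → List A) (xs : List B) (g : A → ℕ) →
              ∑ (concatMap F xs) g ≡ ∑ xs (λ x → ∑ (F x) g)
∑-concatMap F []       g = refl
∑-concatMap F (x ∷ xs) g = trans (∑-++ (F x) (concatMap F xs) g) (cong (_+_ (∑ (F x) g)) (∑-concatMap F xs g))

∑-distrib-+ : ∀ (xs : List A) (g h : A → ℕ) → ∑ xs (λ x → g x + h x) ≡ ∑ xs g + ∑ xs h
∑-distrib-+ []       g h = refl
∑-distrib-+ (x ∷ xs) g h = trans (cong (_+_ (g x + h x)) (∑-distrib-+ xs g h)) (+-interchange (g x) (h x) _ _)

∑-comm : (xs : List A) (ys : List B) (g : A → B → ℕ) →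
         ∑ xs (λ x → ∑ ys (g x)) ≡ ∑ ys (λ y → ∑ xs (λ x → g x y))
∑-comm []       ys g = sym (∑-zero ys (λ _ → refl))
∑-comm (x ∷ xs) ys g = trans (cong (_+_ (∑ ys (g x))) (∑-comm xs ys g))
                             (sym (∑-distrib-+ ys (g x) (λ y → ∑ xs (λ x′ → g x′ y))))

∑-applyUpTo-zero : ∀ (f : ℕ → ℕ) n (g : ℕ → ℕ) → (∀ a → g (f a) ≡ 0) → ∑ (applyUpTo f n) g ≡ 0
∑-applyUpTo-zero f zero    g g∘f≗0 = refl
∑-applyUpTo-zero f (suc n) g g∘f≗0 = cong₂ _+_ (g∘f≗0 0) (∑-applyUpTo-zero (f ∘ suc) n g (g∘f≗0 ∘ suc))

∑-applyUpTo-single : ∀ (f : ℕ → ℕ) n (g : ℕ → ℕ) {c} → c < n →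
                     (∀ a → a ≢ c → g (f a) ≡ 0) → ∑ (applyUpTo f n) g ≡ g (f c)
∑-applyUpTo-single f (suc n) g {zero} _ g∘f≗0 =
  trans (cong (_+_ (g (f 0))) (∑-applyUpTo-zero (f ∘ suc) n g (λ a → g∘f≗0 (suc a) (λ ())))) (+-identityʳ _)
∑-applyUpTo-single f (suc n) g {suc c} (s≤s c<n) g∘f≗0 =
  cong₂ _+_ (g∘f≗0 0 (λ ()))
            (∑-applyUpTo-single (f ∘ suc) n g c<n (λ a a≢c → g∘f≗0 (suc a) (a≢c ∘ suc-injective)))

-- Polynomials in N variables with coefficients in ℕ, as lists of terms

Term Poly : ℕ → Set
Term N = ℕ × Vec ℕ N
Poly N = List (Term N)

module _ {N : ℕ} where

  coeffₜ : Term N → Vec ℕ N → ℕ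
  coeffₜ (a , e) ℓ = δ e ℓ a

  coeff : Poly N → Vec ℕ N → ℕ
  coeff P ℓ = ∑ P (λ t → coeffₜ t ℓ)

  infixl 7 _·ₜ_ _⊗_

  _·ₜ_ : Term N → Term N → Term N
  (a , u) ·ₜ (b , v) = (a * b , u ⊕ v)

  _⊗_ : Poly N → Poly N → Poly N
  []      ⊗ Q = []
  (t ∷ P) ⊗ Q = List.map (t ·ₜ_) Q ++ P ⊗ Q

  𝟏 : Poly N
  𝟏 = [ (1 , 𝟎) ]

  infixr 8 _^_

  _^_ : Poly N → ℕ → Poly N
  P ^ zero  = 𝟏
  P ^ suc k = P ⊗ P ^ k

  coeff-++ : ∀ P Q ℓ → coeff (P ++ Q) ℓ ≡ coeff P ℓ + coeff Q ℓ
  coeff-++ P Q ℓ = ∑-++ P Q (λ t → coeffₜ t ℓ)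

  coeff-⊗ : ∀ P Q ℓ → coeff (P ⊗ Q) ℓ ≡ ∑ P (λ t → ∑ Q (λ s → coeffₜ (t ·ₜ s) ℓ))
  coeff-⊗ []      Q ℓ = refl
  coeff-⊗ (t ∷ P) Q ℓ = trans (coeff-++ (List.map (t ·ₜ_) Q) (P ⊗ Q) ℓ)
                              (cong₂ _+_ (∑-map (t ·ₜ_) Q (λ s → coeffₜ s ℓ)) (coeff-⊗ P Q ℓ))

  coeff-·ₜ-⊗ : ∀ a u Q ℓ →
    coeff (List.map ((a , u) ·ₜ_) Q) ℓ ≡ a * δ (u ⊕ (ℓ ⊖ u)) ℓ (coeff Q (ℓ ⊖ u))
  coeff-·ₜ-⊗ a u []            ℓ = sym (trans (cong (a *_) (δ-zero (u ⊕ (ℓ ⊖ u)) ℓ)) (*-zeroʳ a))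
  coeff-·ₜ-⊗ a u ((b , v) ∷ Q) ℓ = begin
    δ (u ⊕ v) ℓ (a * b) + coeff (List.map ((a , u) ·ₜ_) Q) ℓ
      ≡⟨ cong₂ _+_ (trans (δ-*ˡ (u ⊕ v) ℓ a b) (cong (a *_) (δ-⊕-shift u v ℓ b))) (coeff-·ₜ-⊗ a u Q ℓ) ⟩
    a * δ e ℓ (δ v (ℓ ⊖ u) b) + a * δ e ℓ (coeff Q (ℓ ⊖ u))
      ≡⟨ *-distribˡ-+ a _ _ ⟨
    a * (δ e ℓ (δ v (ℓ ⊖ u) b) + δ e ℓ (coeff Q (ℓ ⊖ u)))
      ≡⟨ cong (a *_) (δ-distrib-+ e ℓ _ _) ⟨
    a * δ e ℓ (δ v (ℓ ⊖ u) b + coeff Q (ℓ ⊖ u)) ∎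
    where
    open ≡-Reasoning
    e = u ⊕ (ℓ ⊖ u)

  ·ₜ-comm : ∀ t s → t ·ₜ s ≡ s ·ₜ t
  ·ₜ-comm (a , u) (b , v) = cong₂ _,_ (*-comm a b) (⊕-comm u v)

  ·ₜ-assoc : ∀ t s r → (t ·ₜ s) ·ₜ r ≡ t ·ₜ (s ·ₜ r)
  ·ₜ-assoc (a , u) (b , v) (c , w) = cong₂ _,_ (*-assoc a b c) (⊕-assoc u v w)

  coeff-⊗-comm : ∀ P Q ℓ → coeff (P ⊗ Q) ℓ ≡ coeff (Q ⊗ P) ℓ
  coeff-⊗-comm P Q ℓ = begin
    coeff (P ⊗ Q) ℓ                              ≡⟨ coeff-⊗ P Q ℓ ⟩
    ∑ P (λ t → ∑ Q (λ s → coeffₜ (t ·ₜ s) ℓ))    ≡⟨ ∑-comm P Q _ ⟩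
    ∑ Q (λ s → ∑ P (λ t → coeffₜ (t ·ₜ s) ℓ))    ≡⟨ ∑-cong Q (λ s → ∑-cong P (λ t → cong (λ r → coeffₜ r ℓ) (·ₜ-comm t s))) ⟩
    ∑ Q (λ s → ∑ P (λ t → coeffₜ (s ·ₜ t) ℓ))    ≡⟨ coeff-⊗ Q P ℓ ⟨
    coeff (Q ⊗ P) ℓ                              ∎
    where open ≡-Reasoning

  ⊗-distribʳ-++ : ∀ P Q R → (P ++ Q) ⊗ R ≡ P ⊗ R ++ Q ⊗ R
  ⊗-distribʳ-++ []      Q R = refl
  ⊗-distribʳ-++ (t ∷ P) Q R = trans (cong (List.map (t ·ₜ_) R ++_) (⊗-distribʳ-++ P Q R))
                                    (sym (List.++-assoc (List.map (t ·ₜ_) R) (P ⊗ R) (Q ⊗ R)))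

  map-·ₜ-⊗ : ∀ t Q R → List.map (t ·ₜ_) Q ⊗ R ≡ List.map (t ·ₜ_) (Q ⊗ R)
  map-·ₜ-⊗ t []      R = refl
  map-·ₜ-⊗ t (s ∷ Q) R = begin
    List.map ((t ·ₜ s) ·ₜ_) R ++ List.map (t ·ₜ_) Q ⊗ R
      ≡⟨ cong₂ _++_ (trans (List.map-cong (·ₜ-assoc t s) R) (List.map-∘ R)) (map-·ₜ-⊗ t Q R) ⟩
    List.map (t ·ₜ_) (List.map (s ·ₜ_) R) ++ List.map (t ·ₜ_) (Q ⊗ R)
      ≡⟨ List.map-++ (t ·ₜ_) (List.map (s ·ₜ_) R) (Q ⊗ R) ⟨
    List.map (t ·ₜ_) (List.map (s ·ₜ_) R ++ Q ⊗ R) ∎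
    where open ≡-Reasoning

  ⊗-assoc : ∀ P Q R → (P ⊗ Q) ⊗ R ≡ P ⊗ (Q ⊗ R)
  ⊗-assoc []      Q R = refl
  ⊗-assoc (t ∷ P) Q R = trans (⊗-distribʳ-++ (List.map (t ·ₜ_) Q) (P ⊗ Q) R)
                              (cong₂ _++_ (map-·ₜ-⊗ t Q R) (⊗-assoc P Q R))

  ⊗-identityˡ : ∀ P → 𝟏 ⊗ P ≡ P
  ⊗-identityˡ P = begin
    List.map ((1 , 𝟎) ·ₜ_) P ++ [] ≡⟨ List.++-identityʳ _ ⟩
    List.map ((1 , 𝟎) ·ₜ_) P       ≡⟨ List.map-cong (λ (b , v) → cong₂ _,_ (+-identityʳ b) (⊕-identityˡ v)) P ⟩
    List.map (λ t → t) P           ≡⟨ List.map-id P ⟩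
    P                              ∎
    where open ≡-Reasoning

  ^-+ : ∀ P m n → P ^ (m + n) ≡ P ^ m ⊗ P ^ n
  ^-+ P zero    n = sym (⊗-identityˡ (P ^ n))
  ^-+ P (suc m) n = trans (cong (P ⊗_) (^-+ P m n)) (sym (⊗-assoc P (P ^ m) (P ^ n)))

  ^-* : ∀ P n k → P ^ (n * k) ≡ (P ^ k) ^ n
  ^-* P zero    k = refl
  ^-* P (suc n) k = trans (^-+ P k (n * k)) (cong (P ^ k ⊗_) (^-* P n k))

module Coefficientwise {N : ℕ} (_∼_ : ℕ → ℕ → Set) (∼-isEquivalence : IsEquivalence _∼_)
  (∼-+ : ∀ {a b c d} → a ∼ b → c ∼ d → (a + c) ∼ (b + d))
  (∼-*ˡ : ∀ a {b c} → b ∼ c → (a * b) ∼ (a * c))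
  (G : Vec ℕ N → Set) (G-⊖ : ∀ {ℓ} u → G ℓ → G (ℓ ⊖ u)) where

  open IsEquivalence ∼-isEquivalence renaming (refl to ∼-refl; sym to ∼-sym; trans to ∼-trans)

  infix 4 _≈_

  record _≈_ (P Q : Poly N) : Set where
    constructor coeffwise
    field coeff-∼ : ∀ ℓ → G ℓ → coeff P ℓ ∼ coeff Q ℓ
  open _≈_ public

  ≈-isEquivalence : IsEquivalence _≈_
  ≈-isEquivalence = record
    { refl  = coeffwise λ _ _ → ∼-refl
    ; sym   = λ P≈Q → coeffwise λ ℓ g → ∼-sym (coeff-∼ P≈Q ℓ g)
    ; trans = λ P≈Q Q≈R → coeffwise λ ℓ g → ∼-trans (coeff-∼ P≈Q ℓ g) (coeff-∼ Q≈R ℓ g)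
    }

  ≈-setoid : Setoid 0ℓ 0ℓ
  ≈-setoid = record { isEquivalence = ≈-isEquivalence }

  coeff-≡⇒≈ : ∀ {P Q} → (∀ ℓ → coeff P ℓ ≡ coeff Q ℓ) → P ≈ Q
  coeff-≡⇒≈ P≗Q = coeffwise λ ℓ _ → reflexive (P≗Q ℓ)

  ≡⇒≈ : ∀ {P Q} → P ≡ Q → P ≈ Q
  ≡⇒≈ refl = coeff-≡⇒≈ λ _ → refl

  ++-cong : ∀ {P P′ Q Q′} → P ≈ P′ → Q ≈ Q′ → P ++ Q ≈ P′ ++ Q′
  ++-cong {P} {P′} {Q} {Q′} P≈P′ Q≈Q′ = coeffwise λ ℓ g →
    subst₂ _∼_ (sym (coeff-++ P Q ℓ)) (sym (coeff-++ P′ Q′ ℓ)) (∼-+ (coeff-∼ P≈P′ ℓ g) (coeff-∼ Q≈Q′ ℓ g))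

  -- Multiplication by a term (a , u) reads Q only at ℓ ⊖ u, which stays in G.
  ⊗-congˡ : ∀ P {Q Q′} → Q ≈ Q′ → P ⊗ Q ≈ P ⊗ Q′
  ⊗-congˡ []            Q≈Q′ = coeffwise λ _ _ → ∼-refl
  ⊗-congˡ ((a , u) ∷ P) {Q} {Q′} Q≈Q′ = ++-cong (coeffwise λ ℓ g →
    subst₂ _∼_ (sym (coeff-·ₜ-⊗ a u Q ℓ)) (sym (coeff-·ₜ-⊗ a u Q′ ℓ))
      (∼-*ˡ a (δ-preserves {_∼_ = _∼_} ∼-refl (u ⊕ (ℓ ⊖ u)) ℓ (coeff-∼ Q≈Q′ (ℓ ⊖ u) (G-⊖ u g)))))
    (⊗-congˡ P Q≈Q′)

  ⊗-comm : ∀ P Q → P ⊗ Q ≈ Q ⊗ P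
  ⊗-comm P Q = coeff-≡⇒≈ (coeff-⊗-comm P Q)

  ⊗-cong : ∀ {P P′ Q Q′} → P ≈ P′ → Q ≈ Q′ → P ⊗ Q ≈ P′ ⊗ Q′
  ⊗-cong {P} {P′} {Q} {Q′} P≈P′ Q≈Q′ = begin
    P ⊗ Q   ≈⟨ ⊗-congˡ P Q≈Q′ ⟩
    P ⊗ Q′  ≈⟨ ⊗-comm P Q′ ⟩
    Q′ ⊗ P  ≈⟨ ⊗-congˡ Q′ P≈P′ ⟩
    Q′ ⊗ P′ ≈⟨ ⊗-comm Q′ P′ ⟩
    P′ ⊗ Q′ ∎
    where open SetoidReasoning ≈-setoid

  ^-congˡ : ∀ {P P′} → P ≈ P′ → ∀ k → P ^ k ≈ P′ ^ k
  ^-congˡ P≈P′ zero    = coeffwise λ _ _ → ∼-refl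
  ^-congˡ P≈P′ (suc k) = ⊗-cong P≈P′ (^-congˡ P≈P′ k)

-- binom(k, ℓ)_f as a coefficient

generatingPoly : ∀ {N} → (Vec ℕ N → ℕ) → List (Vec ℕ N) → Poly N
generatingPoly f B = List.map (λ b → (f b , b)) B

module _ {N : ℕ} (f : Vec ℕ N → ℕ) where

  weight : ∀ {k} → Vec (Vec ℕ N) k → ℕ
  weight t = Vec.foldr _ (λ m r → f m * r) 1 t

  tupleTerm : ∀ {k} → Vec (Vec ℕ N) k → Term N
  tupleTerm t = (weight t , vsum t)

  tupleTerms-cons : ∀ {k} (B : List (Vec ℕ N)) (T : List (Vec (Vec ℕ N) k)) →
    List.map tupleTerm (concatMap (λ b → List.map (b ∷_) T) B) ≡ generatingPoly f B ⊗ List.map tupleTerm T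
  tupleTerms-cons []      T = refl
  tupleTerms-cons (b ∷ B) T =
    trans (List.map-++ tupleTerm (List.map (b ∷_) T) (concatMap (λ b → List.map (b ∷_) T) B))
          (cong₂ _++_ (trans (sym (List.map-∘ T)) (List.map-∘ T)) (tupleTerms-cons B T))

  tupleTerms≡^ : ∀ k (B : List (Vec ℕ N)) → List.map tupleTerm (tuplesFrom k B) ≡ generatingPoly f B ^ k
  tupleTerms≡^ zero    B = refl
  tupleTerms≡^ (suc k) B =
    trans (tupleTerms-cons B (tuplesFrom k B)) (cong (generatingPoly f B ⊗_) (tupleTerms≡^ k B))

  sum-filter≡coeff : ∀ {k} ℓ (T : List (Vec (Vec ℕ N) k)) →
    sum (List.map weight (filter (λ t → ≡-dec _≟_ (vsum t) ℓ) T)) ≡ coeff (List.map tupleTerm T) ℓ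
  sum-filter≡coeff ℓ []      = refl
  sum-filter≡coeff ℓ (t ∷ T) with ≡-dec _≟_ (vsum t) ℓ
  ... | yes _ = cong (_+_ (weight t)) (sum-filter≡coeff ℓ T)
  ... | no  _ = sum-filter≡coeff ℓ T

  gbinom≡coeff : ∀ k ℓ → gbinom f k ℓ ≡ coeff (generatingPoly f (box ℓ) ^ k) ℓ
  gbinom≡coeff k ℓ =
    trans (sum-filter≡coeff ℓ (tuplesFrom k (box ℓ))) (cong (λ P → coeff P ℓ) (tupleTerms≡^ k (box ℓ)))

coeff-generatingPoly : ∀ {N} (g : Vec ℕ N → ℕ) B w → coeff (generatingPoly g B) w ≡ ∑ B (λ b → δ b w (g b))
coeff-generatingPoly g B w = ∑-map (λ b → (g b , b)) B (λ t → coeffₜ t w)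

∑-box-δ : ∀ {N} (g : Vec ℕ N → ℕ) {ℓ w : Vec ℕ N} → w ≤ᵥ ℓ → ∑ (box ℓ) (λ b → δ b w (g b)) ≡ g w
∑-box-δ g []                                 = +-identityʳ (δ [] [] (g []))
∑-box-δ g {x ∷ ℓ} {c ∷ w} (c≤x ∷ w≤ℓ) = begin
  ∑ (box (x ∷ ℓ)) (λ b → δ b (c ∷ w) (g b))
    ≡⟨ ∑-concatMap (λ a → List.map (a ∷_) (box ℓ)) (upTo (suc x)) _ ⟩
  ∑ (upTo (suc x)) (λ a → ∑ (List.map (a ∷_) (box ℓ)) (λ b → δ b (c ∷ w) (g b)))
    ≡⟨ ∑-cong (upTo (suc x)) (λ a → ∑-map (a ∷_) (box ℓ) _) ⟩
  ∑ (upTo (suc x)) (λ a → ∑ (box ℓ) (λ b → δ (a ∷ b) (c ∷ w) (g (a ∷ b))))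
    ≡⟨ ∑-applyUpTo-single (λ a → a) (suc x) _ (s≤s c≤x)
         (λ a a≢c → ∑-zero (box ℓ) (λ b → δ-≢ _ (a≢c ∘ ∷-injectiveˡ))) ⟩
  ∑ (box ℓ) (λ b → δ (c ∷ b) (c ∷ w) (g (c ∷ b)))
    ≡⟨ ∑-cong (box ℓ) (λ b → δ-injective ∷-injectiveʳ b w _) ⟩
  ∑ (box ℓ) (λ b → δ b w (g (c ∷ b)))
    ≡⟨ ∑-box-δ (g ∘ (c ∷_)) w≤ℓ ⟩
  g (c ∷ w) ∎
  where open ≡-Reasoning

coeff-generatingPoly-box : ∀ {N} (g : Vec ℕ N → ℕ) {ℓ w : Vec ℕ N} → w ≤ᵥ ℓ →
                           coeff (generatingPoly g (box ℓ)) w ≡ g w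
coeff-generatingPoly-box g {ℓ} {w} w≤ℓ = trans (coeff-generatingPoly g (box ℓ) w) (∑-box-δ g w≤ℓ)

-- The coefficient of Fᵏ at m only involves the coefficients of F at exponents ≤ m.
coeff-^-box : ∀ {N} (g : Vec ℕ N → ℕ) {ℓ m : Vec ℕ N} → m ≤ᵥ ℓ → ∀ k →
  coeff (generatingPoly g (box ℓ) ^ k) m ≡ coeff (generatingPoly g (box m) ^ k) m
coeff-^-box g {ℓ} {m} m≤ℓ k = coeff-∼ (^-congˡ boxes-agree k) m (Pointwise.refl ≤-refl)
  where
  open Coefficientwise _≡_ isEquivalence (cong₂ _+_) (λ a → cong (a *_)) (_≤ᵥ m) ⊖-≤ᵥ
  boxes-agree : generatingPoly g (box ℓ) ≈ generatingPoly g (box m)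
  boxes-agree = coeffwise λ w w≤m →
    trans (coeff-generatingPoly-box g (Pointwise.trans ≤-trans w≤m m≤ℓ)) (sym (coeff-generatingPoly-box g w≤m))

infix 4 _≡_mod_

record _≡_mod_ (a b p : ℕ) .{{_ : NonZero p}} : Set where
  constructor modular
  field %-≡ : a % p ≡ b % p
open _≡_mod_

module _ {p : ℕ} .{{_ : NonZero p}} where

  ≡-mod-isEquivalence : IsEquivalence (λ a b → a ≡ b mod p)
  ≡-mod-isEquivalence = record
    { refl  = modular refl
    ; sym   = λ a≡b → modular (sym (%-≡ a≡b))
    ; trans = λ a≡b b≡c → modular (trans (%-≡ a≡b) (%-≡ b≡c))
    }

  ≡-mod-setoid : Setoid 0ℓ 0ℓ
  ≡-mod-setoid = record { isEquivalence = ≡-mod-isEquivalence }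

  module ≡-mod-Reasoning = SetoidReasoning ≡-mod-setoid

  +-cong-mod : ∀ {a b c d} → a ≡ b mod p → c ≡ d mod p → a + c ≡ b + d mod p
  +-cong-mod {a} {b} {c} {d} (modular a≡b) (modular c≡d) =
    modular (trans (%-distribˡ-+ a c p) (trans (cong₂ (λ x y → (x + y) % p) a≡b c≡d) (sym (%-distribˡ-+ b d p))))

  *-congˡ-mod : ∀ a {b c} → b ≡ c mod p → a * b ≡ a * c mod p
  *-congˡ-mod a {b} {c} (modular b≡c) =
    modular (trans (%-distribˡ-* a b p) (trans (cong (λ x → ((a % p) * x) % p) b≡c) (sym (%-distribˡ-* a c p))))

  p*n≡0-mod : ∀ n → p * n ≡ 0 mod p
  p*n≡0-mod n = modular (trans (cong (_% p) (*-comm p n)) (trans (m*n%n≡0 n p) (sym (m*n%n≡0 0 p))))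

  ≡-mod⇒∣∸ : ∀ {a b} → a ≡ b mod p → p ℕ.∣ a ∸ b
  ≡-mod⇒∣∸ {a} {b} (modular a≡b) = ℕ.divides (a / p ∸ b / p) (begin
    a ∸ b                                    ≡⟨ cong₂ _∸_ (m≡m%n+[m/n]*n a p) (m≡m%n+[m/n]*n b p) ⟩
    (a % p + a / p * p) ∸ (b % p + b / p * p) ≡⟨ cong (λ r → (a % p + a / p * p) ∸ (r + b / p * p)) a≡b ⟨
    (a % p + a / p * p) ∸ (a % p + b / p * p) ≡⟨ [m+n]∸[m+o]≡n∸o (a % p) _ _ ⟩
    a / p * p ∸ b / p * p                    ≡⟨ *-distribʳ-∸ p (a / p) (b / p) ⟨
    (a / p ∸ b / p) * p                      ∎)
    where open ≡-Reasoning

  ≡-mod⇒∣- : ∀ {a b} → a ≡ b mod p → (+ p) ∣ (+ a - + b)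
  ≡-mod⇒∣- {a} {b} a≡b with ≤-total b a
  ... | inj₁ b≤a = subst (λ z → p ℕ.∣ ℤ.∣ z ∣) (sym (trans (m-n≡m⊖n a b) (⊖-≥ b≤a))) (≡-mod⇒∣∸ a≡b)
  ... | inj₂ a≤b = subst (p ℕ.∣_) (sym (trans (cong ℤ.∣_∣ (m-n≡m⊖n a b)) (∣⊖∣-≤ a≤b)))
                         (≡-mod⇒∣∸ (Setoid.sym ≡-mod-setoid a≡b))

module PolynomialsModulo (N p : ℕ) .{{_ : NonZero p}} where

  open Coefficientwise {N} (λ a b → a ≡ b mod p) ≡-mod-isEquivalence +-cong-mod *-congˡ-mod
                        (λ _ → ⊤) (λ _ _ → tt) public

  commutativeSemiring : CommutativeSemiring 0ℓ 0ℓ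
  commutativeSemiring = record
    { Carrier = Poly N ; _≈_ = _≈_ ; _+_ = _++_ ; _*_ = _⊗_ ; 0# = [] ; 1# = 𝟏
    ; isCommutativeSemiring = isCommutativeSemiringˡ record
      { +-isCommutativeMonoid = isCommutativeMonoidˡ record
        { isSemigroup = record
          { isMagma = record { isEquivalence = ≈-isEquivalence ; ∙-cong = ++-cong }
          ; assoc   = λ P Q R → ≡⇒≈ (List.++-assoc P Q R) }
        ; identityˡ = λ P → ≡⇒≈ refl
        ; comm      = λ P Q → coeff-≡⇒≈ λ ℓ →
            trans (coeff-++ P Q ℓ) (trans (+-comm (coeff P ℓ) (coeff Q ℓ)) (sym (coeff-++ Q P ℓ))) }
      ; *-isCommutativeMonoid = isCommutativeMonoidˡ record
        { isSemigroup = record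
          { isMagma = record { isEquivalence = ≈-isEquivalence ; ∙-cong = ⊗-cong }
          ; assoc   = λ P Q R → ≡⇒≈ (⊗-assoc P Q R) }
        ; identityˡ = λ P → ≡⇒≈ (⊗-identityˡ P)
        ; comm      = ⊗-comm }
      ; distribʳ = λ P Q R → ≡⇒≈ (⊗-distribʳ-++ Q R P)
      ; zeroˡ    = λ P → ≡⇒≈ refl
      }
    }
    where
    open Biased _≈_ using (isCommutativeSemiringˡ; isCommutativeMonoidˡ)

module _ {N : ℕ} where

  -- dilate c P is P(xᶜ).
  dilate : ℕ → Poly N → Poly N
  dilate c = List.map λ (a , e) → (a , c ·v e)

  dilate-⊗ : ∀ c P Q → dilate c (P ⊗ Q) ≡ dilate c P ⊗ dilate c Q
  dilate-⊗ c []      Q = refl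
  dilate-⊗ c ((a , u) ∷ P) Q =
    trans (List.map-++ _ (List.map ((a , u) ·ₜ_) Q) (P ⊗ Q)) (cong₂ _++_ dilate-map (dilate-⊗ c P Q))
    where
    dilate-map : dilate c (List.map ((a , u) ·ₜ_) Q) ≡ List.map ((a , c ·v u) ·ₜ_) (dilate c Q)
    dilate-map = trans (sym (List.map-∘ Q))
      (trans (List.map-cong (λ (b , v) → cong (a * b ,_) (·v-distrib-⊕ c u v)) Q) (List.map-∘ Q))

  dilate-^ : ∀ c P k → dilate c (P ^ k) ≡ dilate c P ^ k
  dilate-^ c P zero    = cong (λ v → [ (1 , v) ]) (·v-zeroʳ c)
  dilate-^ c P (suc k) = trans (dilate-⊗ c P (P ^ k)) (cong (dilate c P ⊗_) (dilate-^ c P k))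

  coeff-dilate : ∀ c .{{_ : NonZero c}} P m → coeff (dilate c P) (c ·v m) ≡ coeff P m
  coeff-dilate c P m = trans (∑-map _ P (λ t → coeffₜ t (c ·v m)))
                             (∑-cong P λ (a , e) → δ-injective (·v-injective c) e m a)

  -- Writing a xᵉ as a sum of a unit monomials lets the additivity of Frobenius handle coefficients.
  unitExpansion : Poly N → List (Vec ℕ N)
  unitExpansion []            = []
  unitExpansion ((a , e) ∷ P) = List.replicate a e ++ unitExpansion P

  monomials : List (Vec ℕ N) → Poly N
  monomials = List.map (1 ,_)

  coeff-monomials-replicate : ∀ a (e ℓ : Vec ℕ N) → coeff (monomials (List.replicate a e)) ℓ ≡ δ e ℓ a
  coeff-monomials-replicate zero    e ℓ = sym (δ-zero e ℓ)
  coeff-monomials-replicate (suc a) e ℓ =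
    trans (cong (_+_ (δ e ℓ 1)) (coeff-monomials-replicate a e ℓ)) (sym (δ-distrib-+ e ℓ 1 a))

  coeff-monomials-unitExpansion : ∀ P ℓ → coeff (monomials (unitExpansion P)) ℓ ≡ coeff P ℓ
  coeff-monomials-unitExpansion []            ℓ = refl
  coeff-monomials-unitExpansion ((a , e) ∷ P) ℓ = begin
    coeff (monomials (List.replicate a e ++ unitExpansion P)) ℓ
      ≡⟨ cong (λ Q → coeff Q ℓ) (List.map-++ (1 ,_) (List.replicate a e) (unitExpansion P)) ⟩
    coeff (monomials (List.replicate a e) ++ monomials (unitExpansion P)) ℓ
      ≡⟨ coeff-++ (monomials (List.replicate a e)) (monomials (unitExpansion P)) ℓ ⟩
    coeff (monomials (List.replicate a e)) ℓ + coeff (monomials (unitExpansion P)) ℓ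
      ≡⟨ cong₂ _+_ (coeff-monomials-replicate a e ℓ) (coeff-monomials-unitExpansion P ℓ) ⟩
    δ e ℓ a + coeff P ℓ ∎
    where open ≡-Reasoning

  dilate-unitExpansion : ∀ c P → List.map (c ·v_) (unitExpansion P) ≡ unitExpansion (dilate c P)
  dilate-unitExpansion c []            = refl
  dilate-unitExpansion c ((a , e) ∷ P) =
    trans (List.map-++ (c ·v_) (List.replicate a e) (unitExpansion P))
          (cong₂ _++_ (List.map-replicate (c ·v_) a e) (dilate-unitExpansion c P))

  monomial-^ : ∀ (e : Vec ℕ N) k → [ (1 , e) ] ^ k ≡ [ (1 , k ·v e) ]
  monomial-^ e zero    = cong (λ v → [ (1 , v) ]) (sym (·v-zeroˡ e))
  monomial-^ e (suc k) =
    trans (cong ([ (1 , e) ] ⊗_) (monomial-^ e k)) (cong (λ v → [ (1 , v) ]) (sym (·v-suc k e)))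

-- Frobenius for polynomials

module _ {N q : ℕ} (p-prime : Prime (suc q)) where

  private
    p = suc q
  open PolynomialsModulo N p
  open CommutativeSemiring commutativeSemiring using (semiring; setoid)
  open import Algebra.Properties.Semiring.Mult semiring using () renaming (_×_ to _·_)
  open import Algebra.Properties.Semiring.Exp semiring using () renaming (_^_ to _^ₚ_)
  private module ≈-Reasoning = SetoidReasoning setoid

  ^ₚ≡^ : ∀ P k → P ^ₚ k ≡ P ^ k
  ^ₚ≡^ P zero    = refl
  ^ₚ≡^ P (suc k) = cong (P ⊗_) (^ₚ≡^ P k)

  coeff-· : ∀ n P ℓ → coeff (n · P) ℓ ≡ n * coeff P ℓ
  coeff-· zero    P ℓ = refl
  coeff-· (suc n) P ℓ = trans (coeff-++ P (n · P) ℓ) (cong (_+_ (coeff P ℓ)) (coeff-· n P ℓ))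

  p·≈0 : ∀ P → p · P ≈ []
  p·≈0 P = coeffwise λ ℓ _ → subst (_≡ 0 mod p) (sym (coeff-· p P ℓ)) (p*n≡0-mod (coeff P ℓ))

  ^-distrib-++ : ∀ P Q → (P ++ Q) ^ p ≈ P ^ p ++ Q ^ p
  ^-distrib-++ P Q = begin
    (P ++ Q) ^ p      ≡⟨ ^ₚ≡^ (P ++ Q) p ⟨
    (P ++ Q) ^ₚ p     ≈⟨ ^-distrib-+-prime commutativeSemiring p-prime p·≈0 P Q ⟩
    P ^ₚ p ++ Q ^ₚ p  ≡⟨ cong₂ _++_ (^ₚ≡^ P p) (^ₚ≡^ Q p) ⟩
    P ^ p ++ Q ^ p    ∎
    where open ≈-Reasoning

  monomials-^ : ∀ U → monomials U ^ p ≈ monomials (List.map (p ·v_) U)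
  monomials-^ []      = ≡⇒≈ refl
  monomials-^ (e ∷ U) = begin
    ([ (1 , e) ] ++ monomials U) ^ p                     ≈⟨ ^-distrib-++ [ (1 , e) ] (monomials U) ⟩
    [ (1 , e) ] ^ p ++ monomials U ^ p                   ≈⟨ ++-cong (≡⇒≈ (monomial-^ e p)) (monomials-^ U) ⟩
    [ (1 , p ·v e) ] ++ monomials (List.map (p ·v_) U)   ∎
    where open ≈-Reasoning

  ^p≈dilate : ∀ P → P ^ p ≈ dilate p P
  ^p≈dilate P = begin
    P ^ p                                             ≈⟨ ^-congˡ P≈expansion p ⟩
    monomials (unitExpansion P) ^ p                   ≈⟨ monomials-^ (unitExpansion P) ⟩
    monomials (List.map (p ·v_) (unitExpansion P))   ≡⟨ cong monomials (dilate-unitExpansion p P) ⟩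
    monomials (unitExpansion (dilate p P))            ≈⟨ coeff-≡⇒≈ (coeff-monomials-unitExpansion (dilate p P)) ⟩
    dilate p P                                        ∎
    where
    open ≈-Reasoning
    P≈expansion : P ≈ monomials (unitExpansion P)
    P≈expansion = coeff-≡⇒≈ λ ℓ → sym (coeff-monomials-unitExpansion P ℓ)

  coeff-^-*p : ∀ P n m → coeff (P ^ (n * p)) (p ·v m) ≡ coeff (P ^ n) m mod p
  coeff-^-*p P n m = begin
    coeff (P ^ (n * p)) (p ·v m)      ≡⟨ cong (λ Q → coeff Q (p ·v m)) (^-* P n p) ⟩
    coeff ((P ^ p) ^ n) (p ·v m)      ≈⟨ coeff-∼ (^-congˡ (^p≈dilate P) n) (p ·v m) tt ⟩
    coeff (dilate p P ^ n) (p ·v m)   ≡⟨ cong (λ Q → coeff Q (p ·v m)) (dilate-^ p P n) ⟨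
    coeff (dilate p (P ^ n)) (p ·v m) ≡⟨ coeff-dilate p (P ^ n) m ⟩
    coeff (P ^ n) m                   ∎
    where open ≡-mod-Reasoning

theorem8 : (N : ℕ) → N ≥ 1 → (f : Vec ℕ N → ℕ) → (p : ℕ) → Prime p →
    (n : ℕ) → (m : Vec ℕ N) →
    (+ p) ∣ ((+ gbinom f (n * p) (p ·v m)) - (+ gbinom f n m))
theorem8 N _ f zero    p-prime n m = contradiction (prime⇒nonZero p-prime) λ ()
theorem8 N _ f (suc q) p-prime n m = ≡-mod⇒∣- (begin
  gbinom f (n * p) (p ·v m)                     ≡⟨ gbinom≡coeff f (n * p) (p ·v m) ⟩
  coeff (F ^ (n * p)) (p ·v m)                  ≈⟨ coeff-^-*p p-prime F n m ⟩
  coeff (F ^ n) m                               ≡⟨ coeff-^-box f (≤ᵥ-·v p (Pointwise.refl ≤-refl)) n ⟩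
  coeff (generatingPoly f (box m) ^ n) m        ≡⟨ gbinom≡coeff f n m ⟨
  gbinom f n m                                  ∎)
  where
  p = suc q
  F = generatingPoly f (box (p ·v m))
  open ≡-mod-Reasoning
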